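{- Let $\alpha,\beta,\gamma\in\mathrm{ord}$. If $\alpha<\gamma$ and $\beta<\gamma$, then $\sup(\alpha,\beta)<\gamma$.
   Context: The setting is constructive. Let $\mathfrak F$ be a set of index sets containing $\mathbb N$ and every $\mathbb N_k=\{n\in\mathbb N:n<k\}$, closed (up to isomorphism) under finitely enumerated subsets, sets of finitely enumerated subsets, and disjoint unions indexed by elements of $\mathfrak F$. The set $\mathrm{ord}=\mathrm{ord}_{\mathfrak F}$ is defined inductively: a distinguished element $\underline 0$, and for every $I\in\mathfrak F$ and family $(\alpha_i)_{i\in I}$ in $\mathrm{ord}$ an element $\mathrm S(\alpha_i)_{i\in I}$; $\mathrm{ord}^*$ is the set of these. For $\alpha=\mathrm S(\alpha_i)_{i\in I}$, $\mathrm{In}_\alpha=I$; by convention $\mathrm{In}_{\underline0}=\emptyset$. For a finite list $F\subseteq_f\mathrm{In}_\alpha$, $\alpha_F$ is the list of the $\alpha_i$, $i\in F$. By simultaneous induction ($m\ge1$): $\alpha\le\beta^1,\dots,\beta^m$ means $\alpha_i<\beta^1,\dots,\beta^m$ for all $i\in\mathrm{In}_\alpha$; $\alpha<\beta^1,\dots,\beta^m$ means there exist $F_k\subseteq_f\mathrm{In}_{\beta^k}$, not all empty, with $\alpha\le\beta^1_{F_1},\dots,\beta^m_{F_m}$; $m=1$ gives binary $\le,<$. For a family $(\alpha^j)_{j\in J}$ in $\mathrm{ord}^*$ with $\alpha^j=\mathrm S((\alpha^j)_i)_{i\in I_j}$, $\sup(\alpha^j)_{j\in J}=\mathrm S(\varepsilon_k)_{k\in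 K}$ where $K$ is the disjoint union of the $I_j$ and $\varepsilon_k=(\alpha^j)_i$ when $k$ is the image of $i\in I_j$; for a finite family in $\mathrm{ord}$, $\sup(\alpha^1,\dots,\alpha^r)$ is $\underline0$ if all $\alpha^k=\underline0$, else the sup of those $\alpha^k\in\mathrm{ord}^*$. -}

module Defs where

open import Data.Nat using (ℕ)
open import Data.Fin using (Fin; zero; suc)
open import Data.List using (List; []; _∷_; _++_; map; length)
open import Data.List.Membership.Propositional using (_∈_)
open import Data.Product using (Σ; _×_; _,_; proj₁; proj₂)
open import Data.Unit using (⊤; tt)
open import Data.Empty using (⊥)
open import Relation.Nullary using (¬_)
open import Relation.Binary.PropositionalEquality using (_≡_)
open import Function.Bundles using (_↔_; Inverse)

-- A universe 𝔉 of index sets, given by codes U decoded by El, together with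
-- the closure properties of the paper (each "up to isomorphism").
record Universe : Set₁ where
  field
    U   : Set
    El  : U → Set
    nat     : U
    nat-iso : El nat ↔ ℕ
    fin     : ℕ → U
    fin-iso : (k : ℕ) → El (fin k) ↔ Fin k
    -- a finitely enumerated subset {i₀,…,i_{n-1}} of I ∈ 𝔉 is in 𝔉
    -- (given by its enumeration)
    sub     : (I : U) → List (El I) → U
    sub-iso : (I : U) (xs : List (El I)) → El (sub I xs) ↔ Fin (length xs)
    pow     : U → U
    pow-iso : (I : U) → El (pow I) ↔ List (El I)
    sig     : (J : U) → (El J → U) → U
    sig-iso : (J : U) (I : El J → U) → El (sig J I) ↔ Σ (El J) (λ j → El (I j))

module OrdDefs (𝔘 : Universe) where
  open Universe 𝔘

  data Ord : Set where
    𝟎 : Ord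
    S : (I : U) → (El I → Ord) → Ord

  In : Ord → Set
  In 𝟎       = ⊥
  In (S I f) = El I

  component : (α : Ord) → In α → Ord
  component 𝟎       ()
  component (S I f) i = f i

  pick : (α : Ord) → List (In α) → List Ord
  pick α F = map (component α) F

  Sel : List Ord → Set
  Sel []       = ⊤
  Sel (β ∷ βs) = List (In β) × Sel βs

  picks : (βs : List Ord) → Sel βs → List Ord
  picks []       _        = []
  picks (β ∷ βs) (F , Fs) = pick β F ++ picks βs Fs

  AllEmpty : (βs : List Ord) → Sel βs → Set
  AllEmpty []       _        = ⊤
  AllEmpty (β ∷ βs) (F , Fs) = (F ≡ []) × AllEmpty βs Fs

  _≤*_ : Ord → List Ord → Set
  _<*_ : Ord → List Ord → Set
  𝟎       ≤* βs = ⊤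
  (S I f) ≤* βs = (i : El I) → f i <* βs
  α <* βs = Σ (Sel βs) (λ Fs → ¬ AllEmpty βs Fs × (α ≤* picks βs Fs))

  _≤_ : Ord → Ord → Set
  α ≤ β = α ≤* (β ∷ [])

  _<_ : Ord → Ord → Set
  α < β = α <* (β ∷ [])

  supFam : (J : U) (I : El J → U) → ((j : El J) → El (I j) → Ord) → Ord
  supFam J I f = S (sig J I) (λ k → let p = Inverse.to (sig-iso J I) k
                                     in f (proj₁ p) (proj₂ p))

  fam1 : {A : Set} → A → El (fin 1) → A
  fam1 a _ = a

  fam2 : {A : Set} → A → A → El (fin 2) → A
  fam2 a b j with Inverse.to (fin-iso 2) j
  ... | zero     = a
  ... | suc zero = b

  sup : Ord → Ord → Ord
  sup 𝟎         𝟎         = 𝟎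
  sup (S I f)   𝟎         = supFam (fin 1) (fam1 I) (λ _ → f)
  sup 𝟎         (S I′ f′) = supFam (fin 1) (fam1 I′) (λ _ → f′)
  sup (S I f)   (S I′ f′) =
    supFam (fin 2) (fam2 I I′) (λ j → helper j)
    where
      helper : (j : El (fin 2)) → El (fam2 I I′ j) → Ord
      helper j with Inverse.to (fin-iso 2) j
      ... | zero     = f
      ... | suc zero = f′

{-# OPTIONS --safe #-}
-- If α ≤ γ_F and β ≤ γ_G, then every component of sup(α, β) is a component
-- of α or of β, hence below γ_F or below γ_G, hence below γ_F, γ_G = γ_{F ++ G}
-- (a strict bound by a list survives extending the list: pad the selection
-- with empty lists). F ++ G is nonempty because F is, so sup(α, β) < γ.

module Submission where

open import Defs
open import Data.Fin using (zero; suc)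
open import Data.List using (List; []; _∷_; _++_)
open import Data.List.Properties using (++-identityʳ; ++-conicalˡ; map-++)
open import Data.Product using (_,_)
open import Data.Unit using (tt)
open import Relation.Binary.PropositionalEquality using (_≡_; _≢_; refl; sym; cong; subst)
open import Function.Bundles using (Inverse)

module _ (𝔘 : Universe) where
  open Universe 𝔘
  open OrdDefs 𝔘

  emptySel : (L : List Ord) → Sel L
  emptySel []      = tt
  emptySel (_ ∷ L) = [] , emptySel L

  picks-emptySel : (L : List Ord) → picks L (emptySel L) ≡ []
  picks-emptySel []      = refl
  picks-emptySel (_ ∷ L) = picks-emptySel L

  padʳ : (L M : List Ord) → Sel L → Sel (L ++ M)
  padʳ []      M _        = emptySel M
  padʳ (_ ∷ L) M (F , Fs) = F , padʳ L M Fs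

  picks-padʳ : (L M : List Ord) (Fs : Sel L) → picks (L ++ M) (padʳ L M Fs) ≡ picks L Fs
  picks-padʳ []      M _        = picks-emptySel M
  picks-padʳ (β ∷ L) M (F , Fs) = cong (pick β F ++_) (picks-padʳ L M Fs)

  AllEmpty-padʳ⁻ : (L M : List Ord) (Fs : Sel L) → AllEmpty (L ++ M) (padʳ L M Fs) → AllEmpty L Fs
  AllEmpty-padʳ⁻ []      M _        _        = tt
  AllEmpty-padʳ⁻ (_ ∷ L) M (_ , Fs) (e , es) = e , AllEmpty-padʳ⁻ L M Fs es

  padˡ : (L M : List Ord) → Sel M → Sel (L ++ M)
  padˡ []      M Fs = Fs
  padˡ (_ ∷ L) M Fs = [] , padˡ L M Fs

  picks-padˡ : (L M : List Ord) (Fs : Sel M) → picks (L ++ M) (padˡ L M Fs) ≡ picks M Fs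
  picks-padˡ []      M _  = refl
  picks-padˡ (_ ∷ L) M Fs = picks-padˡ L M Fs

  AllEmpty-padˡ⁻ : (L M : List Ord) (Fs : Sel M) → AllEmpty (L ++ M) (padˡ L M Fs) → AllEmpty M Fs
  AllEmpty-padˡ⁻ []      M _  e        = e
  AllEmpty-padˡ⁻ (_ ∷ L) M Fs (_ , es) = AllEmpty-padˡ⁻ L M Fs es

  <*-++⁺ˡ : (α : Ord) (L M : List Ord) → α <* L → α <* (L ++ M)
  <*-++⁺ˡ α L M (Fs , ¬empty , α≤) =
    padʳ L M Fs ,
    (λ e → ¬empty (AllEmpty-padʳ⁻ L M Fs e)) ,
    subst (α ≤*_) (sym (picks-padʳ L M Fs)) α≤

  <*-++⁺ʳ : (α : Ord) (L M : List Ord) → α <* M → α <* (L ++ M)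
  <*-++⁺ʳ α L M (Fs , ¬empty , α≤) =
    padˡ L M Fs ,
    (λ e → ¬empty (AllEmpty-padˡ⁻ L M Fs e)) ,
    subst (α ≤*_) (sym (picks-padˡ L M Fs)) α≤

  sup-≤*-++ : (α β : Ord) (L M : List Ord) → α ≤* L → β ≤* M → sup α β ≤* (L ++ M)
  sup-≤*-++ 𝟎       𝟎        L M _  _  = tt
  sup-≤*-++ (S I f) 𝟎        L M α≤ _  k = <*-++⁺ˡ _ L M (α≤ _)
  sup-≤*-++ 𝟎       (S I′ f′) L M _  β≤ k = <*-++⁺ʳ _ L M (β≤ _)
  sup-≤*-++ (S I f) (S I′ f′) L M α≤ β≤ k
    with Inverse.to (sig-iso (fin 2) (fam2 I I′)) k
  ... | j , i with Inverse.to (fin-iso 2) j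
  ... | zero     = <*-++⁺ˡ _ L M (α≤ i)
  ... | suc zero = <*-++⁺ʳ _ L M (β≤ i)

  <-intro : (α γ : Ord) (F : List (In γ)) → F ≢ [] → α ≤* pick γ F → α < γ
  <-intro α γ F F≢[] α≤ =
    (F , tt) , (λ (F≡[] , _) → F≢[] F≡[]) , subst (α ≤*_) (sym (++-identityʳ _)) α≤

lemma4p4 : (𝔘 : Universe) → let open OrdDefs 𝔘 in
    (α β γ : Ord) → α < γ → β < γ → sup α β < γ
lemma4p4 𝔘 α β γ ((F , tt) , F-nonempty , α≤) ((G , tt) , _ , β≤) =
  <-intro 𝔘 (sup α β) γ (F ++ G) (λ F++G≡[] → F-nonempty (++-conicalˡ F G F++G≡[] , tt))
    (subst (sup α β ≤*_) (sym (map-++ (component γ) F G))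
      (sup-≤*-++ 𝔘 α β (pick γ F) (pick γ G) (unpad α≤) (unpad β≤)))
  where
    open OrdDefs 𝔘

    unpad : {δ : Ord} {L : List Ord} → δ ≤* (L ++ []) → δ ≤* L
    unpad {δ} {L} = subst (δ ≤*_) (++-identityʳ L)
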